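{- Let $G$ be a treelike comparability graph. Then $G$ has no induced subgraph isomorphic to the cycle $C_4$ if and only if $G$ does not contain a strict-double-arborescence as an induced subgraph.
   Context: A graph is a comparability graph if it admits a transitive orientation. A treelike comparability graph is one admitting a transitive orientation (its treelike orientation) whose Hasse diagram (transitive reduction), as an undirected graph, is a tree. A double-arborescence is a treelike comparability graph $G=(V,E)$ with a vertex $r$ (a root) such that $V=\{r\}\cup N_G(r)$; it is an arborescence if, under the treelike orientation, a root is a source (indegree zero) or a sink (outdegree zero). A strict-double-arborescence is a double-arborescence that is not an arborescence. -}

module Defs where

open import Data.Nat using (ℕ; zero; suc)
open import Data.Fin using (Fin; zero; suc; inject₁; fromℕ)
open import Data.Bool using (Bool; true; false)
open import Data.Product using (Σ; ∃; _×_; _,_)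
open import Data.Sum using (_⊎_)
open import Data.Empty using (⊥)
open import Relation.Nullary using (¬_)
open import Relation.Binary.PropositionalEquality using (_≡_)
open import Function.Definitions using (Injective; Bijective)

record Graph (n : ℕ) : Set where
  field
    adj    : Fin n → Fin n → Bool
    sym    : ∀ u v → adj u v ≡ adj v u
    irrefl : ∀ v → adj v v ≡ false

open Graph public

Edge : ∀ {n} → Graph n → Fin n → Fin n → Set
Edge G u v = adj G u v ≡ true

induce : ∀ {n m} → Graph n → (Fin m → Fin n) → Graph m
induce G f = record
  { adj    = λ i j → adj G (f i) (f j)
  ; sym    = λ i j → sym G (f i) (f j)
  ; irrefl = λ i → irrefl G (f i)
  }

Iso : ∀ {m k} → Graph m → Graph k → Set
Iso {m} {k} G H =
  Σ (Fin m → Fin k) λ g → Bijective _≡_ _≡_ g ×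
    (∀ i j → adj H (g i) (g j) ≡ adj G i j)

c4adj : Fin 4 → Fin 4 → Bool
c4adj zero (suc zero) = true
c4adj zero (suc (suc (suc zero))) = true
c4adj (suc zero) zero = true
c4adj (suc zero) (suc (suc zero)) = true
c4adj (suc (suc zero)) (suc zero) = true
c4adj (suc (suc zero)) (suc (suc (suc zero))) = true
c4adj (suc (suc (suc zero))) (suc (suc zero)) = true
c4adj (suc (suc (suc zero))) zero = true
c4adj _ _ = false

C4 : Graph 4
C4 = record { adj = c4adj ; sym = s ; irrefl = r }
  where
  s : ∀ u v → c4adj u v ≡ c4adj v u
  s zero zero = _≡_.refl
  s zero (suc zero) = _≡_.refl
  s zero (suc (suc zero)) = _≡_.refl
  s zero (suc (suc (suc zero))) = _≡_.refl
  s (suc zero) zero = _≡_.refl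
  s (suc zero) (suc zero) = _≡_.refl
  s (suc zero) (suc (suc zero)) = _≡_.refl
  s (suc zero) (suc (suc (suc zero))) = _≡_.refl
  s (suc (suc zero)) zero = _≡_.refl
  s (suc (suc zero)) (suc zero) = _≡_.refl
  s (suc (suc zero)) (suc (suc zero)) = _≡_.refl
  s (suc (suc zero)) (suc (suc (suc zero))) = _≡_.refl
  s (suc (suc (suc zero))) zero = _≡_.refl
  s (suc (suc (suc zero))) (suc zero) = _≡_.refl
  s (suc (suc (suc zero))) (suc (suc zero)) = _≡_.refl
  s (suc (suc (suc zero))) (suc (suc (suc zero))) = _≡_.refl
  r : ∀ v → c4adj v v ≡ false
  r zero = _≡_.refl
  r (suc zero) = _≡_.refl
  r (suc (suc zero)) = _≡_.refl
  r (suc (suc (suc zero))) = _≡_.refl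

Walk : ∀ {n} → (Fin n → Fin n → Set) → Fin n → Fin n → Set
Walk {n} R u v =
  Σ ℕ λ k → Σ (Fin (suc k) → Fin n) λ w →
    (w zero ≡ u) × (w (fromℕ k) ≡ v) ×
    (∀ (i : Fin k) → R (w (inject₁ i)) (w (suc i)))

Connected : ∀ {n} → (Fin n → Fin n → Set) → Set
Connected {n} R = ∀ (u v : Fin n) → Walk R u v

Cycle : ∀ {n} → (Fin n → Fin n → Set) → Set
Cycle {n} R =
  Σ ℕ λ k → Σ (Fin (suc (suc (suc k))) → Fin n) λ c →
    Injective _≡_ _≡_ c ×
    (∀ (i : Fin (suc (suc k))) → R (c (inject₁ i)) (c (suc i))) ×
    R (c (fromℕ (suc (suc k)))) (c zero)

IsTree : ∀ {n} → (Fin n → Fin n → Set) → Set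
IsTree R = Connected R × ¬ Cycle R

-- D u v ≡ true means the edge uv is oriented u → v
record IsTransitiveOrientation {n} (G : Graph n) (D : Fin n → Fin n → Bool) : Set where
  field
    onEdges    : ∀ u v → D u v ≡ true → Edge G u v
    covers     : ∀ u v → Edge G u v → D u v ≡ true ⊎ D v u ≡ true
    antisym    : ∀ u v → D u v ≡ true → D v u ≡ false
    transitive : ∀ u v w → D u v ≡ true → D v w ≡ true → D u w ≡ true

Cover : ∀ {n} → (Fin n → Fin n → Bool) → Fin n → Fin n → Set
Cover {n} D u v = D u v ≡ true × (∀ (w : Fin n) → D u w ≡ true → D w v ≡ true → ⊥)

HasseAdj : ∀ {n} → (Fin n → Fin n → Bool) → Fin n → Fin n → Set
HasseAdj D u v = Cover D u v ⊎ Cover D v u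

IsTreelikeOrientation : ∀ {n} → Graph n → (Fin n → Fin n → Bool) → Set
IsTreelikeOrientation G D = IsTransitiveOrientation G D × IsTree (HasseAdj D)

TreelikeComparability : ∀ {n} → Graph n → Set
TreelikeComparability {n} G = Σ (Fin n → Fin n → Bool) λ D → IsTreelikeOrientation G D

IsRoot : ∀ {n} → Graph n → Fin n → Set
IsRoot {n} G r = ∀ (v : Fin n) → v ≡ r ⊎ Edge G r v

IsSource : ∀ {n} → (Fin n → Fin n → Bool) → Fin n → Set
IsSource {n} D r = ∀ (v : Fin n) → D v r ≡ false

IsSink : ∀ {n} → (Fin n → Fin n → Bool) → Fin n → Set
IsSink {n} D r = ∀ (v : Fin n) → D r v ≡ false

DoubleArborescence : ∀ {n} → Graph n → Set
DoubleArborescence {n} G = TreelikeComparability G × Σ (Fin n) λ r → IsRoot G r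

Arborescence : ∀ {n} → Graph n → Set
Arborescence {n} G =
  DoubleArborescence G ×
  Σ (Fin n → Fin n → Bool) λ D → IsTreelikeOrientation G D ×
    Σ (Fin n) λ r → IsRoot G r × (IsSource D r ⊎ IsSink D r)

StrictDoubleArborescence : ∀ {n} → Graph n → Set
StrictDoubleArborescence G = DoubleArborescence G × ¬ Arborescence G

HasInducedC4 : ∀ {n} → Graph n → Set
HasInducedC4 {n} G =
  Σ ℕ λ m → Σ (Fin m → Fin n) λ f → Injective _≡_ _≡_ f × Iso (induce G f) C4

HasInducedStrictDoubleArborescence : ∀ {n} → Graph n → Set
HasInducedStrictDoubleArborescence {n} G =
  Σ ℕ λ m → Σ (Fin m → Fin n) λ f → Injective _≡_ _≡_ f ×
    StrictDoubleArborescence (induce G f)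

-- A transitive orientation of an induced C₄ alternates around it: two opposite vertices a, c
-- lie below the other two b, d. If the Hasse diagram has no cycle, some element lies strictly
-- between {a, c} and {b, d}: otherwise shrink b, d to minimal common upper bounds of a, c and
-- then a, c to maximal common lower bounds of b, d, after which the saturated chains
-- a ↗ b ↘ c ↗ d ↘ a are pairwise disjoint and close up to a cycle. That middle element is
-- adjacent to the whole C₄, so G contains an induced wheel W₄. The wheel is a strict
-- double-arborescence: only its hub can be a root, and the same argument inside the wheel
-- puts the hub strictly between rim vertices in every treelike orientation.
-- Conversely, let r be a root of a strict double-arborescence, s a sink and t a source.
-- Neither s nor t is a root, as the graph is not an arborescence, so some y is not adjacent
-- to s and some z not adjacent to t; then t < r < s and z < r < y, and t s z y is an induced C₄.

module Submission where

open import Defs renaming (sym to adj-sym; irrefl to adj-irrefl)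
open import Data.Nat using (ℕ; suc; z≤n; s≤s; _<ᵇ_; _≡ᵇ_)
import Data.Nat as ℕ
open import Data.Nat.Properties using (+-mono-≤; <ᵇ⇒<; <⇒<ᵇ; ≡ᵇ⇒≡; ≡⇒≡ᵇ)
import Data.Nat.Properties as ℕ
open import Data.List.Relation.Binary.Disjoint.Propositional using (Disjoint)
open import Data.Fin using (Fin; zero; suc; inject₁; fromℕ; _≟_)
open import Data.Fin.Patterns using (0F; 1F; 2F; 3F; 4F)
open import Data.Fin.Properties using (any?; all?; ¬∀⟶∃¬; 0≢1+n; suc-injective)
open import Data.Fin.Induction using (spo-wellFounded; spo-noetherian)
open import Data.Bool using (Bool; true; false; not)
open import Data.Bool.Properties using (¬-not; T-≡) renaming (_≟_ to _≟ᵇ_)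
open import Data.Product using (∃; ∃₂; _×_; _,_; proj₁; proj₂)
import Data.Product as Product
open import Data.Sum using (_⊎_; inj₁; inj₂; [_,_]′)
import Data.Sum as Sum
open import Data.Empty using (⊥-elim)
open import Data.Unit using (⊤; tt)
open import Data.List using (List; []; _∷_; _++_; length; lookup)
open import Data.List.Properties using (length-++)
open import Data.List.Membership.Propositional using (_∈_)
open import Data.List.Membership.Propositional.Properties using (∈-++⁻; ∈-lookup)
open import Data.List.Relation.Unary.Any using (here; there)
import Data.List.Relation.Unary.All as All
open import Data.List.Relation.Unary.AllPairs using ([]; _∷_)
open import Data.List.Relation.Unary.Unique.Propositional using (Unique)
open import Data.List.Relation.Unary.Unique.Propositional.Properties using (++⁺)
open import Relation.Nullary using (¬_; Dec; yes; no)
open import Relation.Nullary.Decidable using (_×-dec_; _⊎-dec_; _→-dec_; ¬?; from-yes)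
open import Relation.Binary.PropositionalEquality
  using (_≡_; _≢_; refl; sym; trans; cong; cong₂; subst; isEquivalence)
open import Relation.Binary.Structures using (IsStrictPartialOrder)
open import Relation.Binary.Construct.Closure.Reflexive using (ReflClosure; refl; [_]; reflexive)
import Relation.Binary.Construct.Closure.Reflexive.Properties as ReflClosure
open import Induction.WellFounded using (WellFounded; Acc; acc)
open import Function using (flip; _∘_; id)
import Function.Construct.Identity as Identity
open import Function.Definitions using (Injective)
open import Function.Bundles using (Equivalence; _⇔_; mk⇔)
open import Relation.Binary.Definitions using (tri<; tri≈; tri>)
import Data.Vec.Functional as V

minimal-element : ∀ {n} {_⊏_ : Fin n → Fin n → Set} → WellFounded _⊏_ → (∀ u v → Dec (u ⊏ v)) →
                  {P : Fin n → Set} → (∀ u → Dec (P u)) → ∀ {x} → P x →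
                  ∃ λ m → P m × (∀ y → P y → ¬ y ⊏ m)
minimal-element {n} {_⊏_} wf _⊏?_ {P} P? {x} px = go (wf x) px
  where
  go : ∀ {x} → Acc _⊏_ x → P x → ∃ λ m → P m × (∀ y → P y → ¬ y ⊏ m)
  go {x} (acc rs) px with any? (λ y → P? y ×-dec y ⊏? x)
  ... | yes (y , py , y⊏x) = go (rs y⊏x) py
  ... | no ∄y = x , px , λ y py y⊏x → ∄y (y , py , y⊏x)

data WalkThrough {n} (R : Fin n → Fin n → Set) : Fin n → List (Fin n) → Fin n → Set where
  []  : ∀ {x} → WalkThrough R x [] x
  _∷_ : ∀ {x z vs y} → R x z → WalkThrough R z vs y → WalkThrough R x (x ∷ vs) y

module _ {n} {R : Fin n → Fin n → Set} where

  infixr 5 _++ʷ_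

  _++ʷ_ : ∀ {x y z vs ws} → WalkThrough R x vs y → WalkThrough R y ws z → WalkThrough R x (vs ++ ws) z
  [] ++ʷ q = q
  (r ∷ p) ++ʷ q = r ∷ (p ++ʷ q)

  map-walk : ∀ {S : Fin n → Fin n → Set} → (∀ {u v} → R u v → S u v) →
             ∀ {x vs y} → WalkThrough R x vs y → WalkThrough S x vs y
  map-walk f [] = []
  map-walk f (r ∷ p) = f r ∷ map-walk f p

  walk-nonempty : ∀ {x vs y} → x ≢ y → WalkThrough R x vs y → 1 ℕ.≤ length vs
  walk-nonempty x≢x [] = ⊥-elim (x≢x refl)
  walk-nonempty _ (_ ∷ _) = s≤s z≤n

  step-at : ∀ {x v vs y} → WalkThrough R x (v ∷ vs) y →
            ∀ i → R (lookup (v ∷ vs) (inject₁ i)) (lookup vs i)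
  step-at (r ∷ (_ ∷ _)) zero = r
  step-at (_ ∷ p@(_ ∷ _)) (suc i) = step-at p i

  last-step : ∀ {x v vs y} → WalkThrough R x (v ∷ vs) y → R (lookup (v ∷ vs) (fromℕ (length vs))) y
  last-step (r ∷ []) = r
  last-step (_ ∷ p@(_ ∷ _)) = last-step p

lookup-injective : ∀ {A : Set} {xs : List A} → Unique xs → Injective _≡_ _≡_ (lookup xs)
lookup-injective (_ ∷ _) {zero} {zero} _ = refl
lookup-injective (x∉ ∷ _) {zero} {suc j} eq = ⊥-elim (All.lookup x∉ (∈-lookup j) eq)
lookup-injective (x∉ ∷ _) {suc i} {zero} eq = ⊥-elim (All.lookup x∉ (∈-lookup i) (sym eq))
lookup-injective (_ ∷ u) {suc i} {suc j} eq = cong suc (lookup-injective u eq)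

closed-walk⇒cycle : ∀ {n} {R : Fin n → Fin n → Set} {x vs} →
                    WalkThrough R x vs x → Unique vs → 3 ℕ.≤ length vs → Cycle R
closed-walk⇒cycle {vs = u ∷ v ∷ w ∷ rest} p@(_ ∷ _) distinct _ =
  length rest , lookup (u ∷ v ∷ w ∷ rest) , lookup-injective distinct , step-at p , last-step p
closed-walk⇒cycle {vs = _ ∷ []} _ _ (s≤s ())
closed-walk⇒cycle {vs = _ ∷ _ ∷ []} _ _ (s≤s (s≤s ()))

map-cycle : ∀ {n} {R S : Fin n → Fin n → Set} → (∀ {u v} → R u v → S u v) → Cycle R → Cycle S
map-cycle f (k , c , c-injective , steps , closing) = k , c , c-injective , f ∘ steps , f closing

-- If c₀ is the centre, the edge c₁c₂ misses it; otherwise c₁ is the centre, and so is an end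
-- of the closing edge.
star-acyclic : ∀ {n} {R : Fin n → Fin n → Set} x → (∀ {u v} → R u v → u ≡ x ⊎ v ≡ x) → ¬ Cycle R
star-acyclic x touches (k , c , c-injective , steps , closing) =
  [ (λ c₀≡x → [ 0≢1+n ∘ same c₀≡x , 0≢1+n ∘ same c₀≡x ]′ (touches (steps 1F)))
  , (λ c₁≡x → [ 0≢1+n ∘ suc-injective ∘ same c₁≡x , 0≢1+n ∘ flip same c₁≡x ]′ (touches closing))
  ]′ (touches (steps 0F))
  where
  same : ∀ {i j} → c i ≡ x → c j ≡ x → i ≡ j
  same cᵢ≡x cⱼ≡x = c-injective (trans cᵢ≡x (sym cⱼ≡x))

star-connected : ∀ {n} {R : Fin n → Fin n → Set} x → (∀ {u v} → R u v → R v u) → (∀ u → u ≡ x ⊎ R u x) →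
                 Connected R
star-connected x R-sym spoke u v with spoke u | spoke v
... | inj₁ refl | inj₁ refl = 0 , (λ _ → x) , refl , refl , λ ()
... | inj₁ refl | inj₂ vRx = 1 , (x V.∷ v V.∷ V.[]) , refl , refl , λ { 0F → R-sym vRx }
... | inj₂ uRx | inj₁ refl = 1 , (u V.∷ x V.∷ V.[]) , refl , refl , λ { 0F → uRx }
... | inj₂ uRx | inj₂ vRx = 2 , (u V.∷ x V.∷ v V.∷ V.[]) , refl , refl , λ { 0F → uRx ; 1F → R-sym vRx }

disjoint-++ : ∀ {A : Set} {xs ys zs : List A} → Disjoint xs ys → Disjoint xs zs → Disjoint xs (ys ++ zs)
disjoint-++ {ys = ys} xs#ys xs#zs (e∈xs , e∈ys++zs) =
  [ (λ e∈ys → xs#ys (e∈xs , e∈ys)) , (λ e∈zs → xs#zs (e∈xs , e∈zs)) ]′ (∈-++⁻ ys e∈ys++zs)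

Edge-sym : ∀ {n} (G : Graph n) {u v} → Edge G u v → Edge G v u
Edge-sym G {u} {v} e = trans (adj-sym G v u) e

adjacent⇒distinct : ∀ {n} (G : Graph n) {u v} → Edge G u v → u ≢ v
adjacent⇒distinct G {u} e refl with trans (sym e) (adj-irrefl G u)
... | ()

non-root : ∀ {n} {G : Graph n} {r v} → v ≢ r → adj G r v ≡ false → ¬ IsRoot G r
non-root {v = v} v≢r r≁v r-root with r-root v
... | inj₁ v≡r = v≢r v≡r
... | inj₂ r~v with trans (sym r≁v) r~v
...   | ()

-- Strict orders and their Hasse diagrams

record IsStrictOrder {n} (D : Fin n → Fin n → Bool) : Set where
  field
    antisym    : ∀ u v → D u v ≡ true → D v u ≡ false
    transitive : ∀ u v w → D u v ≡ true → D v w ≡ true → D u w ≡ true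

flip-isStrictOrder : ∀ {n} {D : Fin n → Fin n → Bool} → IsStrictOrder D → IsStrictOrder (flip D)
flip-isStrictOrder so = record
  { antisym = λ u v → antisym v u
  ; transitive = λ u v w p q → transitive w v u q p
  }
  where open IsStrictOrder so

cover-flip : ∀ {n} {D : Fin n → Fin n → Bool} {u v} → Cover (flip D) u v → Cover D v u
cover-flip (v<u , nothing-between) = v<u , λ w v<w w<u → nothing-between w w<u v<w

hasse-flip : ∀ {n} {D : Fin n → Fin n → Bool} {u v} → HasseAdj (flip D) u v → HasseAdj D u v
hasse-flip {D = D} = Sum.swap ∘ Sum.map (cover-flip {D = D}) (cover-flip {D = D})

flip-acyclic : ∀ {n} {D : Fin n → Fin n → Bool} → ¬ Cycle (HasseAdj D) → ¬ Cycle (HasseAdj (flip D))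
flip-acyclic {D = D} acyclic = acyclic ∘ map-cycle (λ {u} {v} → hasse-flip {D = D} {u} {v})

module StrictOrder {n} {D : Fin n → Fin n → Bool} (so : IsStrictOrder D) where

  open IsStrictOrder so

  infix 4 _<_ _≤_ _<?_ _≤?_

  _<_ : Fin n → Fin n → Set
  u < v = D u v ≡ true

  _<?_ : ∀ u v → Dec (u < v)
  u <? v = D u v ≟ᵇ true

  <-irrefl : ∀ {u} → ¬ u < u
  <-irrefl {u} u<u with trans (sym u<u) (antisym u u u<u)
  ... | ()

  <-trans : ∀ {u v w} → u < v → v < w → u < w
  <-trans = transitive _ _ _

  <-isStrictPartialOrder : IsStrictPartialOrder _≡_ _<_
  <-isStrictPartialOrder = record
    { isEquivalence = isEquivalence
    ; irrefl = λ { refl → <-irrefl }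
    ; trans = <-trans
    ; <-resp-≈ = (λ { refl p → p }) , (λ { refl p → p })
    }

  _≤_ : Fin n → Fin n → Set
  _≤_ = ReflClosure _<_

  _≤?_ : ∀ u v → Dec (u ≤ v)
  _≤?_ = ReflClosure.dec _≟_ _<?_

  ≤-trans : ∀ {u v w} → u ≤ v → v ≤ w → u ≤ w
  ≤-trans = ReflClosure.trans <-trans

  <-≤-trans : ∀ {u v w} → u < v → v ≤ w → u < w
  <-≤-trans u<v refl = u<v
  <-≤-trans u<v [ v<w ] = <-trans u<v v<w

  <⇒≢ : ∀ {u v} → u < v → u ≢ v
  <⇒≢ u<u refl = <-irrefl u<u

  ≤∧≢⇒< : ∀ {u v} → u ≤ v → u ≢ v → u < v
  ≤∧≢⇒< refl u≢u = ⊥-elim (u≢u refl)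
  ≤∧≢⇒< [ u<v ] _ = u<v

  <-above-incomparable : ∀ {u w e} → u ≤ e → w ≤ e → ¬ w ≤ u → u < e
  <-above-incomparable u≤e w≤e w≰u = ≤∧≢⇒< u≤e λ { refl → w≰u w≤e }

  <-below-incomparable : ∀ {u w e} → e ≤ u → e ≤ w → ¬ u ≤ w → e < u
  <-below-incomparable e≤u e≤w u≰w = ≤∧≢⇒< e≤u λ { refl → u≰w e≤w }

  minimal : {P : Fin n → Set} → (∀ u → Dec (P u)) → ∀ {x} → P x → ∃ λ m → P m × (∀ y → P y → ¬ y < m)
  minimal = minimal-element (spo-wellFounded <-isStrictPartialOrder) _<?_

  maximal : {P : Fin n → Set} → (∀ u → Dec (P u)) → ∀ {x} → P x → ∃ λ m → P m × (∀ y → P y → ¬ m < y)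
  maximal = minimal-element (spo-noetherian <-isStrictPartialOrder) (flip _<?_)

  sink : Fin n → ∃ (IsSink D)
  sink x with maximal {P = λ _ → ⊤} (λ _ → yes tt) {x} tt
  ... | s , _ , s-maximal = s , λ v → ¬-not (s-maximal v tt)

  <⇒¬source : ∀ {u x} → u < x → ¬ IsSource D x
  <⇒¬source {u} u<x x-source with trans (sym u<x) (x-source u)
  ... | ()

  <⇒¬sink : ∀ {x u} → x < u → ¬ IsSink D x
  <⇒¬sink {u = u} x<u x-sink with trans (sym x<u) (x-sink u)
  ... | ()

  Hasse : Fin n → Fin n → Set
  Hasse = HasseAdj D

  record Chain↑ (x y : Fin n) : Set where
    field
      vertices : List (Fin n)
      walk     : WalkThrough Hasse x vertices y
      distinct : Unique vertices
      bounded  : ∀ {e} → e ∈ vertices → x ≤ e × e < y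

  chain↑ : ∀ {x y} → x < y → Chain↑ x y
  chain↑ {x} x<y = go (spo-noetherian <-isStrictPartialOrder x) x<y
    where
    go : ∀ {x y} → Acc (flip _<_) x → x < y → Chain↑ x y
    go {x} {y} (acc rs) x<y with minimal (λ z → (x <? z) ×-dec (z ≤? y)) (x<y , refl)
    ... | z , (x<z , z≤y) , z-minimal = extend z≤y
      where
      x⋖z : Cover D x z
      x⋖z = x<z , λ w x<w w<z → z-minimal w (x<w , ≤-trans [ w<z ] z≤y) w<z

      extend : z ≤ y → Chain↑ x y
      extend refl = record
        { vertices = x ∷ []
        ; walk = inj₁ x⋖z ∷ []
        ; distinct = All.[] ∷ []
        ; bounded = λ { (here refl) → refl , x<y }
        }
      extend [ z<y ] = record
        { vertices = x ∷ vertices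
        ; walk = inj₁ x⋖z ∷ walk
        ; distinct = All.tabulate (<⇒≢ ∘ x<-above) ∷ distinct
        ; bounded = λ { (here refl) → refl , x<y ; (there e∈) → [ x<-above e∈ ] , proj₂ (bounded e∈) }
        }
        where
        open Chain↑ (go (rs x<z) z<y)
        x<-above : ∀ {e} → e ∈ vertices → x < e
        x<-above e∈ = <-≤-trans x<z (proj₁ (bounded e∈))

module Crowns {n} {D : Fin n → Fin n → Bool} (so : IsStrictOrder D) where

  open StrictOrder so
  private module Op = StrictOrder (flip-isStrictOrder so)

  record Chain↓ (x y : Fin n) : Set where
    field
      vertices : List (Fin n)
      walk     : WalkThrough Hasse y vertices x
      distinct : Unique vertices
      bounded  : ∀ {e} → e ∈ vertices → x < e × e ≤ y

  chain↓ : ∀ {x y} → x < y → Chain↓ x y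
  chain↓ x<y = record
    { vertices = vertices
    ; walk = map-walk (hasse-flip {D = D}) walk
    ; distinct = distinct
    ; bounded = λ e∈ → proj₂ (bounded e∈) , flip-≤ (proj₁ (bounded e∈))
    }
    where
    open Op.Chain↑ (Op.chain↑ x<y)
    flip-≤ : ∀ {u v} → v Op.≤ u → u ≤ v
    flip-≤ refl = refl
    flip-≤ [ u<v ] = [ u<v ]

  Between : Fin n → Fin n → Fin n → Fin n → Fin n → Set
  Between a c b d r = a < r × c < r × r < b × r < d

  record Crown (a c b d : Fin n) : Set where
    field
      a<b : a < b
      a<d : a < d
      c<b : c < b
      c<d : c < d
      a≰c : ¬ a ≤ c
      c≰a : ¬ c ≤ a
      b≰d : ¬ b ≤ d
      d≰b : ¬ d ≤ b

  record TightCrown : Set where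
    field
      a c b d   : Fin n
      a<b       : a < b
      a<d       : a < d
      c<b       : c < b
      c<d       : c < d
      b≢d       : b ≢ d
      b-minimal : ∀ {e} → a ≤ e → c ≤ e → ¬ e < b
      d-minimal : ∀ {e} → a ≤ e → c ≤ e → ¬ e < d
      a-maximal : ∀ {e} → a < e → e ≤ b → ¬ e ≤ d
      c-maximal : ∀ {e} → c < e → e ≤ b → ¬ e ≤ d

  -- A, B, C, E are the saturated chains a ↗ b ↘ c ↗ d ↘ a, and tightness makes them disjoint.
  tight-crown⇒cycle : TightCrown → Cycle Hasse
  tight-crown⇒cycle t = closed-walk⇒cycle (A.walk ++ʷ B.walk ++ʷ C.walk ++ʷ E.walk) distinct long
    where
    open TightCrown t
    module A = Chain↑ (chain↑ a<b)
    module B = Chain↓ (chain↓ c<b)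
    module C = Chain↑ (chain↑ c<d)
    module E = Chain↓ (chain↓ a<d)

    no-common-bound : ∀ {e} → a ≤ e → c ≤ e → e ≤ b → ¬ e ≤ d
    no-common-bound a≤e c≤e refl refl = b≢d refl
    no-common-bound a≤e c≤e refl [ b<d ] = d-minimal a≤e c≤e b<d
    no-common-bound a≤e c≤e [ e<b ] _ = b-minimal a≤e c≤e e<b

    A#B : Disjoint A.vertices B.vertices
    A#B (e∈A , e∈B) with A.bounded e∈A | B.bounded e∈B
    ... | a≤e , e<b | c<e , _ = b-minimal a≤e [ c<e ] e<b

    A#C : Disjoint A.vertices C.vertices
    A#C (e∈A , e∈C) with A.bounded e∈A | C.bounded e∈C
    ... | a≤e , e<b | c≤e , _ = b-minimal a≤e c≤e e<b

    A#E : Disjoint A.vertices E.vertices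
    A#E (e∈A , e∈E) with A.bounded e∈A | E.bounded e∈E
    ... | _ , e<b | a<e , e≤d = a-maximal a<e [ e<b ] e≤d

    B#C : Disjoint B.vertices C.vertices
    B#C (e∈B , e∈C) with B.bounded e∈B | C.bounded e∈C
    ... | c<e , e≤b | _ , e<d = c-maximal c<e e≤b [ e<d ]

    B#E : Disjoint B.vertices E.vertices
    B#E (e∈B , e∈E) with B.bounded e∈B | E.bounded e∈E
    ... | c<e , e≤b | a<e , e≤d = no-common-bound [ a<e ] [ c<e ] e≤b e≤d

    C#E : Disjoint C.vertices E.vertices
    C#E (e∈C , e∈E) with C.bounded e∈C | E.bounded e∈E
    ... | c≤e , e<d | a<e , _ = d-minimal [ a<e ] c≤e e<d

    distinct : Unique (A.vertices ++ B.vertices ++ C.vertices ++ E.vertices)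
    distinct = ++⁺ A.distinct (++⁺ B.distinct (++⁺ C.distinct E.distinct C#E) (disjoint-++ B#C B#E))
                   (disjoint-++ A#B (disjoint-++ A#C A#E))

    long : 3 ℕ.≤ length (A.vertices ++ B.vertices ++ C.vertices ++ E.vertices)
    long rewrite length-++ A.vertices {B.vertices ++ C.vertices ++ E.vertices}
               | length-++ B.vertices {C.vertices ++ E.vertices}
               | length-++ C.vertices {E.vertices}
      = +-mono-≤ (walk-nonempty (<⇒≢ a<b) A.walk)
                 (+-mono-≤ (walk-nonempty (<⇒≢ c<b ∘ sym) B.walk)
                           (+-mono-≤ (walk-nonempty (<⇒≢ c<d) C.walk) z≤n))

  module _ {a c b d} (crown : Crown a c b d) (no-middle : ∀ r → ¬ Between a c b d r) where

    open Crown crown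

    tighten : TightCrown
    tighten
      with minimal (λ y → (a <? y) ×-dec (c <? y) ×-dec (y ≤? b)) (a<b , c<b , refl)
         | minimal (λ y → (a <? y) ×-dec (c <? y) ×-dec (y ≤? d)) (a<d , c<d , refl)
    ... | m , (a<m , c<m , m≤b) , m-minimal | m′ , (a<m′ , c<m′ , m′≤d) , m′-minimal
      with maximal (λ y → (a ≤? y) ×-dec (y ≤? m) ×-dec (y ≤? m′) ×-dec ¬? (c ≤? y))
                   (refl , [ a<m ] , [ a<m′ ] , c≰a)
    ... | a′ , (a≤a′ , a′≤m , a′≤m′ , c≰a′) , a′-maximal
      with maximal (λ y → (c ≤? y) ×-dec (y ≤? m) ×-dec (y ≤? m′) ×-dec ¬? (a′ ≤? y))
                   (refl , [ c<m ] , [ c<m′ ] , λ a′≤c → a≰c (≤-trans a≤a′ a′≤c))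
    ... | c′ , (c≤c′ , c′≤m , c′≤m′ , a′≰c′) , c′-maximal = record
      { a = a′ ; c = c′ ; b = m ; d = m′
      ; a<b = <-above-incomparable a′≤m [ c<m ] c≰a′
      ; a<d = <-above-incomparable a′≤m′ [ c<m′ ] c≰a′
      ; c<b = <-above-incomparable c′≤m a′≤m a′≰c′
      ; c<d = <-above-incomparable c′≤m′ a′≤m′ a′≰c′
      ; b≢d = λ m≡m′ → no-middle-under [ a<m ] [ c<m ] refl (reflexive m≡m′)
      ; b-minimal = λ a′≤e c′≤e e<m → m-minimal _ (above-a,c a′≤e c′≤e [ <-≤-trans e<m m≤b ]) e<m
      ; d-minimal = λ a′≤e c′≤e e<m′ → m′-minimal _ (above-a,c a′≤e c′≤e [ <-≤-trans e<m′ m′≤d ]) e<m′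
      ; a-maximal = a′-maximal-under
      ; c-maximal = c′-maximal-under
      }
      where
      no-middle-under : ∀ {e} → a ≤ e → c ≤ e → e ≤ m → ¬ e ≤ m′
      no-middle-under a≤e c≤e e≤m e≤m′ =
        no-middle _ ( <-above-incomparable a≤e c≤e c≰a , <-above-incomparable c≤e a≤e a≰c
                    , <-below-incomparable e≤b e≤d b≰d , <-below-incomparable e≤d e≤b d≰b )
        where
        e≤b = ≤-trans e≤m m≤b
        e≤d = ≤-trans e≤m′ m′≤d

      above-a,c : ∀ {e y} → a′ ≤ e → c′ ≤ e → e ≤ y → a < e × c < e × e ≤ y
      above-a,c a′≤e c′≤e e≤y = <-above-incomparable a≤e c≤e c≰a , <-above-incomparable c≤e a≤e a≰c , e≤y
        where
        a≤e = ≤-trans a≤a′ a′≤e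
        c≤e = ≤-trans c≤c′ c′≤e

      a′-maximal-under : ∀ {e} → a′ < e → e ≤ m → ¬ e ≤ m′
      a′-maximal-under {e} a′<e e≤m e≤m′ with c ≤? e
      ... | yes c≤e = no-middle-under (≤-trans a≤a′ [ a′<e ]) c≤e e≤m e≤m′
      ... | no c≰e = a′-maximal e (≤-trans a≤a′ [ a′<e ] , e≤m , e≤m′ , c≰e) a′<e

      c′-maximal-under : ∀ {e} → c′ < e → e ≤ m → ¬ e ≤ m′
      c′-maximal-under {e} c′<e e≤m e≤m′ with a′ ≤? e
      ... | yes a′≤e = no-middle-under (≤-trans a≤a′ a′≤e) (≤-trans c≤c′ [ c′<e ]) e≤m e≤m′
      ... | no a′≰e = c′-maximal e (≤-trans c≤c′ [ c′<e ] , e≤m , e≤m′ , a′≰e) c′<e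

  crown-middle : ∀ {a c b d} → ¬ Cycle Hasse → Crown a c b d → ∃ (Between a c b d)
  crown-middle {a} {c} {b} {d} acyclic crown
    with any? (λ r → (a <? r) ×-dec (c <? r) ×-dec (r <? b) ×-dec (r <? d))
  ... | yes middle = middle
  ... | no ∄middle =
    ⊥-elim (acyclic (tight-crown⇒cycle (tighten crown λ r between → ∄middle (r , between))))

module LevelOrder {n} (level : Fin n → ℕ) where

  order : Fin n → Fin n → Bool
  order u v = level u <ᵇ level v

  order⇒< : ∀ {u v} → order u v ≡ true → level u ℕ.< level v
  order⇒< p = <ᵇ⇒< _ _ (Equivalence.from T-≡ p)

  <⇒order : ∀ {u v} → level u ℕ.< level v → order u v ≡ true
  <⇒order p = Equivalence.to T-≡ (<⇒<ᵇ p)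

  module _ (K : Graph n) (adj-level : ∀ u v → adj K u v ≡ not (level u ≡ᵇ level v)) where

    level≢⇒edge : ∀ {u v} → level u ≢ level v → Edge K u v
    level≢⇒edge {u} {v} lu≢lv =
      trans (adj-level u v) (cong not (¬-not (lu≢lv ∘ ≡ᵇ⇒≡ _ _ ∘ Equivalence.from T-≡)))

    edge⇒level≢ : ∀ {u v} → Edge K u v → level u ≢ level v
    edge⇒level≢ {u} {v} e lu≡lv
      with subst (λ b → not b ≡ true) (Equivalence.to T-≡ (≡⇒≡ᵇ _ _ lu≡lv)) (trans (sym (adj-level u v)) e)
    ... | ()

    orientation : IsTransitiveOrientation K order
    orientation = record
      { onEdges = λ u v p → level≢⇒edge (ℕ.<⇒≢ (order⇒< p))
      ; covers = covers
      ; antisym = λ u v p → ¬-not λ q → ℕ.<-asym (order⇒< p) (order⇒< q)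
      ; transitive = λ u v w p q → <⇒order (ℕ.<-trans (order⇒< p) (order⇒< q))
      }
      where
      covers : ∀ u v → Edge K u v → order u v ≡ true ⊎ order v u ≡ true
      covers u v e with ℕ.<-cmp (level u) (level v)
      ... | tri< lu<lv _ _ = inj₁ (<⇒order lu<lv)
      ... | tri≈ _ lu≡lv _ = ⊥-elim (edge⇒level≢ e lu≡lv)
      ... | tri> _ _ lv<lu = inj₂ (<⇒order lv<lu)

  successor-cover : ∀ {u v} → level v ≡ suc (level u) → Cover order u v
  successor-cover {u} {v} lv≡1+lu = <⇒order (ℕ.≤-reflexive (sym lv≡1+lu)) ,
    λ w u<w w<v → ℕ.<⇒≱ (order⇒< u<w) (ℕ.s≤s⁻¹ (subst (suc (level w) ℕ.≤_) lv≡1+lu (order⇒< w<v)))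

-- Transitive orientations and induced 4-cycles

isStrictOrder : ∀ {n} {G : Graph n} {D} → IsTransitiveOrientation G D → IsStrictOrder D
isStrictOrder TO = record { antisym = antisym ; transitive = transitive }
  where open IsTransitiveOrientation TO

flip-orientation : ∀ {n} {G : Graph n} {D} → IsTransitiveOrientation G D → IsTransitiveOrientation G (flip D)
flip-orientation {G = G} TO = record
  { onEdges = λ u v v<u → Edge-sym G (onEdges v u v<u)
  ; covers = λ u v e → Sum.swap (covers u v e)
  ; antisym = IsStrictOrder.antisym (flip-isStrictOrder (isStrictOrder TO))
  ; transitive = IsStrictOrder.transitive (flip-isStrictOrder (isStrictOrder TO))
  }
  where open IsTransitiveOrientation TO

record Square {n} (G : Graph n) : Set where
  field
    vertex    : Fin 4 → Fin n
    injective : Injective _≡_ _≡_ vertex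
    adjacency : ∀ i j → adj G (vertex i) (vertex j) ≡ c4adj i j

  vertex-≢ : ∀ {i j} → i ≢ j → vertex i ≢ vertex j
  vertex-≢ i≢j = i≢j ∘ injective

square : ∀ {n} {G : Graph n} (a b c d : Fin n) → Edge G a b → Edge G b c → Edge G c d → Edge G d a →
         ¬ (c ≡ a ⊎ Edge G a c) → ¬ (d ≡ b ⊎ Edge G b d) → Square G
square {n} {G} a b c d ab bc cd da c∉N[a] d∉N[b] =
  record { vertex = v ; injective = v-injective ; adjacency = v-adjacency }
  where
  v : Fin 4 → Fin n
  v 0F = a
  v 1F = b
  v 2F = c
  v 3F = d

  ac : adj G a c ≡ false
  ac = ¬-not (c∉N[a] ∘ inj₂)

  bd : adj G b d ≡ false
  bd = ¬-not (d∉N[b] ∘ inj₂)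

  v-adjacency : ∀ i j → adj G (v i) (v j) ≡ c4adj i j
  v-adjacency 0F 0F = adj-irrefl G a
  v-adjacency 0F 1F = ab
  v-adjacency 0F 2F = ac
  v-adjacency 0F 3F = Edge-sym G da
  v-adjacency 1F 0F = Edge-sym G ab
  v-adjacency 1F 1F = adj-irrefl G b
  v-adjacency 1F 2F = bc
  v-adjacency 1F 3F = bd
  v-adjacency 2F 0F = trans (adj-sym G c a) ac
  v-adjacency 2F 1F = Edge-sym G bc
  v-adjacency 2F 2F = adj-irrefl G c
  v-adjacency 2F 3F = cd
  v-adjacency 3F 0F = da
  v-adjacency 3F 1F = trans (adj-sym G d b) bd
  v-adjacency 3F 2F = Edge-sym G cd
  v-adjacency 3F 3F = adj-irrefl G d

  v-injective : Injective _≡_ _≡_ v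
  v-injective {0F} {0F} _ = refl
  v-injective {0F} {1F} eq = ⊥-elim (adjacent⇒distinct G ab eq)
  v-injective {0F} {2F} eq = ⊥-elim (c∉N[a] (inj₁ (sym eq)))
  v-injective {0F} {3F} eq = ⊥-elim (adjacent⇒distinct G da (sym eq))
  v-injective {1F} {0F} eq = ⊥-elim (adjacent⇒distinct G ab (sym eq))
  v-injective {1F} {1F} _ = refl
  v-injective {1F} {2F} eq = ⊥-elim (adjacent⇒distinct G bc eq)
  v-injective {1F} {3F} eq = ⊥-elim (d∉N[b] (inj₁ (sym eq)))
  v-injective {2F} {0F} eq = ⊥-elim (c∉N[a] (inj₁ eq))
  v-injective {2F} {1F} eq = ⊥-elim (adjacent⇒distinct G bc (sym eq))
  v-injective {2F} {2F} _ = refl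
  v-injective {2F} {3F} eq = ⊥-elim (adjacent⇒distinct G cd eq)
  v-injective {3F} {0F} eq = ⊥-elim (adjacent⇒distinct G da eq)
  v-injective {3F} {1F} eq = ⊥-elim (d∉N[b] (inj₁ eq))
  v-injective {3F} {2F} eq = ⊥-elim (adjacent⇒distinct G cd (sym eq))
  v-injective {3F} {3F} _ = refl

square⇒induced-C4 : ∀ {n} {G : Graph n} → Square G → HasInducedC4 G
square⇒induced-C4 sq = 4 , vertex , injective , id , Identity.bijective _≡_ , λ i j → sym (adjacency i j)
  where open Square sq

induced-C4⇒square : ∀ {n} {G : Graph n} → HasInducedC4 G → Square G
induced-C4⇒square (m , f , f-injective , g , (g-injective , g-surjective) , g-adjacency) = record
  { vertex = f ∘ preimage
  ; injective = λ eq → trans (sym (g-preimage _)) (trans (cong g (f-injective eq)) (g-preimage _))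
  ; adjacency = λ i j → trans (sym (g-adjacency (preimage i) (preimage j)))
                              (cong₂ c4adj (g-preimage i) (g-preimage j))
  }
  where
  preimage : Fin 4 → Fin m
  preimage i = proj₁ (g-surjective i)
  g-preimage : ∀ i → g (preimage i) ≡ i
  g-preimage i = proj₂ (g-surjective i) refl

lift-square : ∀ {n m} {G : Graph n} {f : Fin m → Fin n} → Injective _≡_ _≡_ f → Square (induce G f) → Square G
lift-square {f = f} f-injective sq = record
  { vertex = f ∘ vertex ; injective = injective ∘ f-injective ; adjacency = adjacency }
  where open Square sq

module Orientation {n} {G : Graph n} {D} (TO : IsTransitiveOrientation G D) where

  open IsTransitiveOrientation TO
  open StrictOrder (isStrictOrder TO)
  open Crowns (isStrictOrder TO)

  unrelated : ∀ {u v} → adj G u v ≡ false → ¬ u < v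
  unrelated u≁v u<v with trans (sym u≁v) (onEdges _ _ u<v)
  ... | ()

  non-adjacent⇒≰ : ∀ {u v} → adj G u v ≡ false → u ≢ v → ¬ u ≤ v
  non-adjacent⇒≰ u≁v u≢u refl = u≢u refl
  non-adjacent⇒≰ u≁v _ [ u<v ] = unrelated u≁v u<v

  orient : ∀ {u v} → Edge G u v → ¬ v < u → u < v
  orient e v≮u = [ id , ⊥-elim ∘ v≮u ]′ (covers _ _ e)

  root-comparable : ∀ {r v} → IsRoot G r → v ≢ r → r < v ⊎ v < r
  root-comparable {r} {v} r-root v≢r = [ ⊥-elim ∘ v≢r , covers r v ]′ (r-root v)

  square-crown : (sq : Square G) → let open Square sq in
                 vertex 0F < vertex 1F → Crown (vertex 0F) (vertex 2F) (vertex 1F) (vertex 3F)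
  square-crown sq v₀<v₁ = record
    { a<b = v₀<v₁ ; a<d = v₀<v₃ ; c<b = v₂<v₁ ; c<d = v₂<v₃
    ; a≰c = non-adjacent⇒≰ (adjacency 0F 2F) (vertex-≢ λ ())
    ; c≰a = non-adjacent⇒≰ (adjacency 2F 0F) (vertex-≢ λ ())
    ; b≰d = non-adjacent⇒≰ (adjacency 1F 3F) (vertex-≢ λ ())
    ; d≰b = non-adjacent⇒≰ (adjacency 3F 1F) (vertex-≢ λ ())
    }
    where
    open Square sq
    v₂<v₁ = orient (adjacency 2F 1F) λ v₁<v₂ → unrelated (adjacency 0F 2F) (<-trans v₀<v₁ v₁<v₂)
    v₀<v₃ = orient (adjacency 0F 3F) λ v₃<v₀ → unrelated (adjacency 3F 1F) (<-trans v₃<v₀ v₀<v₁)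
    v₂<v₃ = orient (adjacency 2F 3F) λ v₃<v₂ → unrelated (adjacency 3F 1F) (<-trans v₃<v₂ v₂<v₁)

  upward-square-centre : ¬ Cycle Hasse → (sq : Square G) → let open Square sq in vertex 0F < vertex 1F →
                         ∃ λ x → (∀ i → Edge G x (vertex i)) × ¬ IsSource D x × ¬ IsSink D x
  upward-square-centre acyclic sq v₀<v₁ with crown-middle acyclic (square-crown sq v₀<v₁)
  ... | x , v₀<x , v₂<x , x<v₁ , x<v₃ = x , adjacent , <⇒¬source v₀<x , <⇒¬sink x<v₁
    where
    open Square sq
    adjacent : ∀ i → Edge G x (vertex i)
    adjacent 0F = Edge-sym G (onEdges _ _ v₀<x)
    adjacent 1F = onEdges _ _ x<v₁
    adjacent 2F = Edge-sym G (onEdges _ _ v₂<x)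
    adjacent 3F = onEdges _ _ x<v₃

  above-root-non-neighbour : ∀ {r} → IsRoot G r → (∀ {s} → IsSink D s → ¬ IsRoot G s) →
                             ∃₂ λ s y → r < s × r < y × ¬ (y ≡ s ⊎ Edge G s y)
  above-root-non-neighbour {r} r-root sink-not-root
    with sink r
  ... | s , s-sink
    with ¬∀⟶∃¬ n _ (λ v → (v ≟ s) ⊎-dec (adj G s v ≟ᵇ true)) (sink-not-root s-sink)
  ... | y , y∉N[s] = s , y , r<s , r<y , y∉N[s]
    where
    r<s : r < s
    r<s = [ id , (λ s<r → ⊥-elim (<⇒¬sink s<r s-sink)) ]′
            (root-comparable r-root λ s≡r → sink-not-root s-sink (subst (IsRoot G) (sym s≡r) r-root))
    s~r : Edge G s r
    s~r = Edge-sym G (onEdges _ _ r<s)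
    r<y : r < y
    r<y = [ id , (λ y<r → ⊥-elim (y∉N[s] (inj₂ (Edge-sym G (onEdges _ _ (<-trans y<r r<s)))))) ]′
            (root-comparable r-root λ y≡r → y∉N[s] (inj₂ (subst (Edge G s) (sym y≡r) s~r)))

square-centre : ∀ {n} {G : Graph n} {D} → IsTransitiveOrientation G D → ¬ Cycle (HasseAdj D) →
                (sq : Square G) → let open Square sq in
                ∃ λ x → (∀ i → Edge G x (vertex i)) × ¬ IsSource D x × ¬ IsSink D x
square-centre {D = D} TO acyclic sq with IsTransitiveOrientation.covers TO _ _ (Square.adjacency sq 0F 1F)
... | inj₁ v₀<v₁ = Orientation.upward-square-centre TO acyclic sq v₀<v₁
... | inj₂ v₁<v₀
  with Orientation.upward-square-centre (flip-orientation TO) (flip-acyclic {D = D} acyclic) sq v₁<v₀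
...   | x , adjacent , not-sink , not-source = x , adjacent , not-source , not-sink

-- The wheel W₄

wheelAdj : Fin 5 → Fin 5 → Bool
wheelAdj zero zero = false
wheelAdj zero (suc _) = true
wheelAdj (suc _) zero = true
wheelAdj (suc i) (suc j) = c4adj i j

wheelLevel : Fin 5 → ℕ
wheelLevel 0F = 1
wheelLevel 1F = 0
wheelLevel 2F = 2
wheelLevel 3F = 0
wheelLevel 4F = 2

wheelAdj-levels : ∀ u v → wheelAdj u v ≡ not (wheelLevel u ≡ᵇ wheelLevel v)
wheelAdj-levels = from-yes (all? λ u → all? λ v → wheelAdj u v ≟ᵇ not (wheelLevel u ≡ᵇ wheelLevel v))

module _ (K : Graph 5) (K≅W₄ : ∀ u v → adj K u v ≡ wheelAdj u v) where

  open LevelOrder wheelLevel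

  rim-through-hub : ∀ i j → order (suc i) (suc j) ≡ true →
                    order (suc i) zero ≡ true × order zero (suc j) ≡ true
  rim-through-hub = from-yes (all? λ i → all? λ j →
    (order (suc i) (suc j) ≟ᵇ true) →-dec (order (suc i) zero ≟ᵇ true) ×-dec (order zero (suc j) ≟ᵇ true))

  hasse-star : ∀ {u v} → HasseAdj order u v → u ≡ zero ⊎ v ≡ zero
  hasse-star {zero} _ = inj₁ refl
  hasse-star {v = zero} _ = inj₂ refl
  hasse-star {suc i} {suc j} (inj₁ (i<j , nothing-between)) =
    ⊥-elim (Product.uncurry (nothing-between zero) (rim-through-hub i j i<j))
  hasse-star {suc i} {suc j} (inj₂ (j<i , nothing-between)) =
    ⊥-elim (Product.uncurry (nothing-between zero) (rim-through-hub j i j<i))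

  spoke : ∀ u → u ≡ zero ⊎ HasseAdj order u zero
  spoke 0F = inj₁ refl
  spoke 1F = inj₂ (inj₁ (successor-cover {1F} {0F} refl))
  spoke 2F = inj₂ (inj₂ (successor-cover {0F} {2F} refl))
  spoke 3F = inj₂ (inj₁ (successor-cover {3F} {0F} refl))
  spoke 4F = inj₂ (inj₂ (successor-cover {0F} {4F} refl))

  wheel-treelike : TreelikeComparability K
  wheel-treelike = order , orientation K (λ u v → trans (K≅W₄ u v) (wheelAdj-levels u v)) ,
                   star-connected zero (λ {u} {v} → Sum.swap {A = Cover order u v}) spoke ,
                   star-acyclic zero hasse-star

  hub-root : IsRoot K zero
  hub-root zero = inj₁ refl
  hub-root (suc i) = inj₂ (K≅W₄ zero (suc i))

  rim : Square K
  rim = record { vertex = suc ; injective = suc-injective ; adjacency = λ i j → K≅W₄ (suc i) (suc j) }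

  adjacent-to-rim⇒hub : ∀ {x} → (∀ i → Edge K x (suc i)) → x ≡ zero
  adjacent-to-rim⇒hub {zero} _ = refl
  adjacent-to-rim⇒hub {suc i} adjacent = ⊥-elim (adjacent⇒distinct K (adjacent i) refl)

  rim-not-root : ∀ i → ¬ IsRoot K (suc i)
  rim-not-root 0F = non-root {G = K} (λ ()) (K≅W₄ 1F 3F)
  rim-not-root 1F = non-root {G = K} (λ ()) (K≅W₄ 2F 4F)
  rim-not-root 2F = non-root {G = K} (λ ()) (K≅W₄ 3F 1F)
  rim-not-root 3F = non-root {G = K} (λ ()) (K≅W₄ 4F 2F)

  wheel-not-arborescence : ¬ Arborescence K
  wheel-not-arborescence (_ , _ , _ , suc i , i-root , _) = rim-not-root i i-root
  wheel-not-arborescence (_ , D , (TO , _ , acyclic) , zero , _ , source-or-sink)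
    with square-centre TO acyclic rim
  ... | x , adjacent , not-source , not-sink with adjacent-to-rim⇒hub adjacent
  ...   | refl = [ not-source , not-sink ]′ source-or-sink

  wheel-strict : StrictDoubleArborescence K
  wheel-strict = (wheel-treelike , zero , hub-root) , wheel-not-arborescence

square⇒induced-wheel : ∀ {n} {G : Graph n} → TreelikeComparability G → Square G →
                       HasInducedStrictDoubleArborescence G
square⇒induced-wheel {n} {G} (D , TO , _ , acyclic) sq with square-centre TO acyclic sq
... | x , adjacent , _ = 5 , h , h-injective , wheel-strict (induce G h) h-adjacency
  where
  open Square sq

  h : Fin 5 → Fin n
  h zero = x
  h (suc i) = vertex i

  h-adjacency : ∀ u v → adj G (h u) (h v) ≡ wheelAdj u v
  h-adjacency zero zero = adj-irrefl G x
  h-adjacency zero (suc j) = adjacent j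
  h-adjacency (suc i) zero = Edge-sym G (adjacent i)
  h-adjacency (suc i) (suc j) = adjacency i j

  h-injective : Injective _≡_ _≡_ h
  h-injective {zero} {zero} _ = refl
  h-injective {zero} {suc j} eq = ⊥-elim (adjacent⇒distinct G (adjacent j) eq)
  h-injective {suc i} {zero} eq = ⊥-elim (adjacent⇒distinct G (adjacent i) (sym eq))
  h-injective {suc i} {suc j} eq = cong suc (injective eq)

strict-double-arborescence⇒square : ∀ {n} {H : Graph n} → StrictDoubleArborescence H → Square H
strict-double-arborescence⇒square {H = H} (da@((D , TO , treelike) , r , r-root) , not-arborescence)
  with Orientation.above-root-non-neighbour TO r-root
         (λ s-sink s-root → not-arborescence (da , D , (TO , treelike) , _ , s-root , inj₂ s-sink))
     | Orientation.above-root-non-neighbour (flip-orientation TO) r-root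
         (λ t-source t-root → not-arborescence (da , D , (TO , treelike) , _ , t-root , inj₁ t-source))
... | s , y , r<s , r<y , y∉N[s] | t , z , t<r , z<r , z∉N[t] =
  square t s z y (onEdges _ _ (<-trans t<r r<s)) (Edge-sym H (onEdges _ _ (<-trans z<r r<s)))
                 (onEdges _ _ (<-trans z<r r<y)) (Edge-sym H (onEdges _ _ (<-trans t<r r<y)))
                 z∉N[t] y∉N[s]
  where
  open IsTransitiveOrientation TO using (onEdges)
  open StrictOrder (isStrictOrder TO) using (<-trans)

theorem5 : ∀ (n : ℕ) (G : Graph n) → TreelikeComparability G →
             ((¬ HasInducedC4 G) ⇔ (¬ HasInducedStrictDoubleArborescence G))
theorem5 n G treelike = mk⇔
  (λ no-C4 (_ , f , f-injective , sda) →
     no-C4 (square⇒induced-C4 (lift-square {G = G} f-injective (strict-double-arborescence⇒square sda))))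
  (λ no-sda C4 → no-sda (square⇒induced-wheel treelike (induced-C4⇒square C4)))
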